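{- Let $q$ be an odd prime power, let $R'$ be the square-free part of the odd part of $q^2-1$, let $m \mid R'$, and let $\theta, \alpha \in \mathbb{F}_{q^2}^*$ with $\mathbb{F}_{q^2} = \mathbb{F}_q(\theta)$. Let $\{r_1,\ldots,r_s\}$ be a set of divisors of $m$ and $r_0$ an integer such that $\gcd(r_i,r_j) = r_0$ for all $i \ne j$ and $\mathrm{lcm}(r_1,\ldots,r_s) = m$. Then \[ \mathcal{N}_m(\theta,\alpha) \ge \sum_{i=1}^s \mathcal{N}_{r_i}(\theta,\alpha) - (s-1)\,\mathcal{N}_{r_0}(\theta,\alpha). \]
   Context: For $l \mid q^2-1$, an element $\xi \in \mathbb{F}_{q^2}^*$ is $l$-free if whenever $\xi = \zeta^d$ with $d \mid l$ and $\zeta \in \mathbb{F}_{q^2}^*$, then $d = 1$. For $l \mid R'$, $\mathcal{N}_l(\theta,\alpha)$ denotes the number of $x \in \mathbb{F}_q$ such that $\alpha(\theta+x)$ is $l$-free, is a square in $\mathbb{F}_{q^2}^*$, and is not a fourth power in $\mathbb{F}_{q^2}^*$. -}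

module Defs where

open import Level using (0ℓ)
open import Data.Nat using (ℕ; zero; suc; _≤_; _^_; _∸_)
open import Data.Nat.Divisibility using (_∣_; _∣?_)
open import Data.Nat.Primality using (Prime; prime?)
open import Data.Nat.LCM using (lcm)
open import Data.Fin using (Fin)
open import Data.List using (List; []; _∷_; length; filter; upTo)
open import Data.Nat.ListAction using (product)
open import Data.List.Membership.Propositional using (_∈_)
open import Data.List.Relation.Unary.Unique.Propositional using (Unique)
open import Data.Product using (Σ; ∃; _×_; _,_)
open import Relation.Binary.PropositionalEquality using (_≡_; _≢_)
open import Relation.Nullary using (¬_)
open import Relation.Nullary.Decidable using (_×-dec_; ¬?)
open import Algebra.Structures using (IsCommutativeRing)
open import Function.Bundles using (_↔_)

OddPrimePower : ℕ → Set
OddPrimePower q = Σ ℕ λ p → Σ ℕ λ k → Prime p × p ≢ 2 × 1 ≤ k × q ≡ p ^ k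

-- R'(n): the square-free part (radical) of the odd part of n,
-- i.e. the product of the distinct odd primes dividing n.
R′ : ℕ → ℕ
R′ n = product (filter (λ p → prime? p ×-dec (¬? (p Data.Nat.≟ 2) ×-dec (p ∣? n))) (upTo (suc n)))

lcmList : List ℕ → ℕ
lcmList []       = 1
lcmList (r ∷ rs) = lcm r (lcmList rs)

record FiniteField (n : ℕ) : Set₁ where
  infixl 7 _*_
  infixl 6 _+_
  field
    Carrier           : Set
    _+_ _*_           : Carrier → Carrier → Carrier
    -_                : Carrier → Carrier
    0# 1#             : Carrier
    isCommutativeRing : IsCommutativeRing _≡_ _+_ _*_ -_ 0# 1#
    0≢1               : 0# ≢ 1#
    inverse           : ∀ x → x ≢ 0# → Σ Carrier λ y → x * y ≡ 1#
    enumeration       : Fin n ↔ Carrier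

  infixr 8 _^ᶠ_
  _^ᶠ_ : Carrier → ℕ → Carrier
  x ^ᶠ zero  = 1#
  x ^ᶠ suc k = x * (x ^ᶠ k)

IsCount : (A : Set) → (A → Set) → ℕ → Set
IsCount A P n = Σ (List A) λ xs → Unique xs × (∀ x → (x ∈ xs → P x) × (P x → x ∈ xs)) × length xs ≡ n

module _ {n : ℕ} (K : FiniteField n) where
  open FiniteField K

  IsFree : ℕ → Carrier → Set
  IsFree l ξ = ∀ d → d ∣ l → ∀ ζ → ζ ≢ 0# → ξ ≡ ζ ^ᶠ d → d ≡ 1

  IsPower : ℕ → Carrier → Set
  IsPower d ξ = Σ Carrier λ ζ → ζ ≢ 0# × ξ ≡ ζ ^ᶠ d

  InSubfield : ℕ → Carrier → Set
  InSubfield q x = x ^ᶠ q ≡ x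

  NProp : ℕ → ℕ → Carrier → Carrier → Carrier → Set
  NProp q l θ α x =
    InSubfield q x × IsFree l (α * (θ + x)) × IsPower 2 (α * (θ + x)) × ¬ IsPower 4 (α * (θ + x))

  IsN : ℕ → ℕ → Carrier → Carrier → ℕ → Set
  IsN q l θ α N = IsCount Carrier (NProp q l θ α) N

module Submission where

-- The sieve inequality  𝒩_m ≥ Σᵢ 𝒩_{rᵢ} − (s−1)·𝒩_{r₀}  is proved by double
-- counting.  Write Sₗ for the set of x with NProp l x (so 𝒩_l = |Sₗ|).  For
-- every element x of the field,
--
--   Σᵢ [x ∈ S_{rᵢ}]  ≤  [x ∈ S_m] + (s−1)·[x ∈ S_{r₀}],
--
-- because (a) x in every S_{rᵢ} forces x ∈ S_m, as an element that is
-- rᵢ-free for every i is lcm(r₁,…,r_s)-free; and (b) when s ≥ 2, x in some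
-- S_{rᵢ} forces x ∈ S_{r₀}, as r₀ = gcd(rᵢ,rⱼ) divides rᵢ and l-freeness
-- passes to divisors of l.  Summing over the field gives the bound in ℕ,
-- which is finally transported to ℤ.

open import Data.Nat using (ℕ)
open import Data.List using (List)
open import Data.List.Membership.Propositional using (_∈_)
open import Data.List.Relation.Unary.Unique.Propositional using (Unique)
open import Relation.Binary.Definitions using (DecidableEquality)
open import Defs using (FiniteField; IsCount)

module IndicatorSums where
  open import Data.Nat using (ℕ; zero; suc; _+_; _*_; _∸_; _≤_; _<_; _≟_; z≤n; s≤s; >-nonZero)
  open import Data.Nat.Properties
    using (+-commutativeSemigroup; *-zeroʳ; *-distribˡ-+; +-mono-≤; ≤-trans;
           m≤m+n; m≤n+m; m≤m*n; m≤n+m∸n; <⇒≤pred; module ≤-Reasoning)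
  open import Data.Nat.ListAction using (sum)
  open import Data.List using (List; []; _∷_; map; length)
  open import Data.List.Relation.Unary.All using (All; []; _∷_; all?)
  open import Data.List.Relation.Unary.Any using (Any; here; there; any?)
  open import Algebra.Properties.CommutativeSemigroup +-commutativeSemigroup using (interchange)
  open import Relation.Binary.PropositionalEquality using (_≡_; refl; sym; trans; cong; subst)
  open import Relation.Nullary using (¬_; yes; no)
  open import Data.Empty using (⊥-elim)

  sum-map-+ : ∀ {A : Set} (f g : A → ℕ) xs →
              sum (map (λ x → f x + g x) xs) ≡ sum (map f xs) + sum (map g xs)
  sum-map-+ f g []       = refl
  sum-map-+ f g (x ∷ xs) =
    trans (cong (f x + g x +_) (sum-map-+ f g xs)) (interchange (f x) (g x) _ _)

  sum-map-* : ∀ {A : Set} k (f : A → ℕ) xs → sum (map (λ x → k * f x) xs) ≡ k * sum (map f xs)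
  sum-map-* k f []       = sym (*-zeroʳ k)
  sum-map-* k f (x ∷ xs) =
    trans (cong (k * f x +_) (sum-map-* k f xs)) (sym (*-distribˡ-+ k (f x) _))

  sum-map-mono : ∀ {A : Set} {f g : A → ℕ} xs → (∀ x → f x ≤ g x) → sum (map f xs) ≤ sum (map g xs)
  sum-map-mono []       f≤g = z≤n
  sum-map-mono (x ∷ xs) f≤g = +-mono-≤ (f≤g x) (sum-map-mono xs f≤g)

  sum-map-zero : ∀ {A : Set} (xs : List A) → sum (map (λ _ → 0) xs) ≡ 0
  sum-map-zero []       = refl
  sum-map-zero (x ∷ xs) = sum-map-zero xs

  sum-map-swap : ∀ {I A : Set} (g : I → A → ℕ) is xs →
    sum (map (λ i → sum (map (g i) xs)) is) ≡ sum (map (λ x → sum (map (λ i → g i x) is)) xs)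
  sum-map-swap g []       xs = sym (sum-map-zero xs)
  sum-map-swap g (i ∷ is) xs =
    trans (cong (sum (map (g i) xs) +_) (sum-map-swap g is xs))
          (sym (sum-map-+ (g i) (λ x → sum (map (λ i → g i x) is)) xs))

  Bits : List ℕ → Set
  Bits = All (_≤ 1)

  sum≤length : ∀ {bs} → Bits bs → sum bs ≤ length bs
  sum≤length []           = z≤n
  sum≤length (b≤1 ∷ bits) = +-mono-≤ b≤1 (sum≤length bits)

  sum<length : ∀ {bs} → Bits bs → ¬ All (_≡ 1) bs → sum bs < length bs
  sum<length {[]}              []           notAll = ⊥-elim (notAll [])
  sum<length {zero ∷ _}        (_ ∷ bits)   _      = s≤s (sum≤length bits)
  sum<length {suc zero ∷ _}    (_ ∷ bits)   notAll = s≤s (sum<length bits (λ all → notAll (refl ∷ all)))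
  sum<length {suc (suc _) ∷ _} (s≤s () ∷ _) _

  sum≡0 : ∀ {bs} → Bits bs → ¬ Any (_≡ 1) bs → sum bs ≡ 0
  sum≡0 {[]}              []           _    = refl
  sum≡0 {zero ∷ _}        (_ ∷ bits)   none = sum≡0 bits (λ some → none (there some))
  sum≡0 {suc zero ∷ _}    _            none = ⊥-elim (none (here refl))
  sum≡0 {suc (suc _) ∷ _} (s≤s () ∷ _) _

  -- With e ≥ 1 the term (s−1)·e absorbs every entry but one, and c ≥ 1
  -- pays for the last entry when all entries are 1.
  indicator-bound-e≥1 : ∀ bs c e → Bits bs → (All (_≡ 1) bs → 1 ≤ c) → 1 ≤ e →
                        sum bs ≤ c + (length bs ∸ 1) * e
  indicator-bound-e≥1 bs c e bits all⇒c 1≤e with all? (_≟ 1) bs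
  ... | yes every = begin
    sum bs                      ≤⟨ sum≤length bits ⟩
    length bs                   ≤⟨ m≤n+m∸n (length bs) 1 ⟩
    1 + (length bs ∸ 1)         ≤⟨ +-mono-≤ (all⇒c every) k≤k*e ⟩
    c + (length bs ∸ 1) * e     ∎
    where open ≤-Reasoning
          k≤k*e = m≤m*n (length bs ∸ 1) e {{>-nonZero 1≤e}}
  ... | no notAll = begin
    sum bs                      ≤⟨ <⇒≤pred (sum<length bits notAll) ⟩
    length bs ∸ 1               ≤⟨ m≤m*n (length bs ∸ 1) e {{>-nonZero 1≤e}} ⟩
    (length bs ∸ 1) * e         ≤⟨ m≤n+m _ c ⟩
    c + (length bs ∸ 1) * e     ∎
    where open ≤-Reasoning

  indicator-bound : ∀ bs c e → Bits bs → (All (_≡ 1) bs → 1 ≤ c) →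
                    (2 ≤ length bs → Any (_≡ 1) bs → 1 ≤ e) →
                    sum bs ≤ c + (length bs ∸ 1) * e
  indicator-bound []                 c e _            _     _ = z≤n
  indicator-bound (zero ∷ [])        c e _            _     _ = z≤n
  indicator-bound (suc zero ∷ [])    c e _            all⇒c _ = ≤-trans (all⇒c (refl ∷ [])) (m≤m+n c 0)
  indicator-bound (suc (suc _) ∷ []) c e (s≤s () ∷ _) _     _
  indicator-bound bs@(_ ∷ _ ∷ _)     c e bits all⇒c some⇒e with any? (_≟ 1) bs
  ... | no none = subst (_≤ c + (length bs ∸ 1) * e) (sym (sum≡0 bits none)) z≤n
  ... | yes some = indicator-bound-e≥1 bs c e bits all⇒c (some⇒e (s≤s (s≤s z≤n)) some)

module Counting {A : Set} (_≟_ : DecidableEquality A)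
                (elements : List A) (elements-unique : Unique elements)
                (elements-complete : ∀ x → x ∈ elements) where
  open import Data.Nat using (ℕ; suc; _+_; _*_; _∸_; _≤_; z≤n; s≤s)
  open import Data.Nat.Properties using (≤-reflexive; module ≤-Reasoning)
  open import Data.Nat.ListAction using (sum)
  open import Data.Fin using (Fin)
  open import Data.List using (List; []; _∷_; map; length; filter; allFin)
  open import Data.List.Properties using (map-cong; length-map; length-tabulate)
  open import Data.List.Membership.DecPropositional _≟_ using (_∈?_)
  open import Data.List.Membership.Propositional.Properties using (∈-filter⁺; ∈-filter⁻; ∈-allFin)
  open import Data.List.Membership.Propositional.Properties.WithK using (unique∧set⇒bag)
  open import Data.List.Relation.Binary.BagAndSetEquality using (∼bag⇒↭; set; _∼[_]_)
  open import Data.List.Relation.Binary.Permutation.Propositional.Properties using (↭-length)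
  import Data.List.Relation.Unary.All as All
  import Data.List.Relation.Unary.All.Properties as All
  open import Data.List.Relation.Unary.Any using (Any; satisfied)
  import Data.List.Relation.Unary.Any.Properties as Any
  open import Data.List.Relation.Unary.Unique.Propositional.Properties using (filter⁺)
  open import Data.Product using (_,_; proj₁; proj₂)
  open import Function.Bundles using (mk⇔)
  open import Relation.Binary.PropositionalEquality using (_≡_; refl; sym; trans; cong; cong₂; subst)
  open import Relation.Nullary using (yes; no)
  open import Data.Empty using (⊥-elim)
  open IndicatorSums

  𝟙 : List A → A → ℕ
  𝟙 xs x with x ∈? xs
  ... | yes _ = 1
  ... | no  _ = 0

  𝟙≤1 : ∀ xs x → 𝟙 xs x ≤ 1
  𝟙≤1 xs x with x ∈? xs
  ... | yes _ = s≤s z≤n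
  ... | no  _ = z≤n

  ∈⇒𝟙≡1 : ∀ {xs x} → x ∈ xs → 𝟙 xs x ≡ 1
  ∈⇒𝟙≡1 {xs} {x} x∈xs with x ∈? xs
  ... | yes _    = refl
  ... | no  x∉xs = ⊥-elim (x∉xs x∈xs)

  𝟙≡1⇒∈ : ∀ {xs x} → 𝟙 xs x ≡ 1 → x ∈ xs
  𝟙≡1⇒∈ {xs} {x} 𝟙≡1 with x ∈? xs
  ... | yes x∈xs = x∈xs
  ... | no  _    with 𝟙≡1
  ...   | ()

  sum-𝟙≡length-filter : ∀ xs ys → sum (map (𝟙 xs) ys) ≡ length (filter (_∈? xs) ys)
  sum-𝟙≡length-filter xs []       = refl
  sum-𝟙≡length-filter xs (y ∷ ys) with y ∈? xs
  ... | yes _ = cong suc (sum-𝟙≡length-filter xs ys)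
  ... | no  _ = sum-𝟙≡length-filter xs ys

  -- The size of a repetition-free list is the sum of its indicator: xs and
  -- the sublist of `elements` lying in xs are both repetition-free and have
  -- the same members, hence are permutations of each other.
  length≡sum-𝟙 : ∀ {xs} → Unique xs → length xs ≡ sum (map (𝟙 xs) elements)
  length≡sum-𝟙 {xs} xs-unique =
    trans (↭-length (∼bag⇒↭ (unique∧set⇒bag xs-unique (filter⁺ (_∈? xs) elements-unique) same-set)))
          (sym (sum-𝟙≡length-filter xs elements))
    where
    same-set : xs ∼[ set ] filter (_∈? xs) elements
    same-set = mk⇔ (∈-filter⁺ (_∈? xs) (elements-complete _))
                   (λ x∈ → proj₂ (∈-filter⁻ (_∈? xs) {xs = elements} x∈))

  count≡sum-𝟙 : ∀ {P n} (count : IsCount A P n) → n ≡ sum (map (𝟙 (proj₁ count)) elements)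
  count≡sum-𝟙 (_ , unique , _ , length≡n) = trans (sym length≡n) (length≡sum-𝟙 unique)

  holds⇒𝟙≡1 : ∀ {P n} (count : IsCount A P n) {x} → P x → 𝟙 (proj₁ count) x ≡ 1
  holds⇒𝟙≡1 (_ , _ , spec , _) {x} Px = ∈⇒𝟙≡1 (proj₂ (spec x) Px)

  𝟙≡1⇒holds : ∀ {P n} (count : IsCount A P n) {x} → 𝟙 (proj₁ count) x ≡ 1 → P x
  𝟙≡1⇒holds (_ , _ , spec , _) {x} 𝟙≡1 = proj₁ (spec x) (𝟙≡1⇒∈ 𝟙≡1)

  counting-bound : ∀ {s} {P : Fin s → A → Set} {Q R : A → Set} {N : Fin s → ℕ} {M L : ℕ} →
    (∀ i → IsCount A (P i) (N i)) → IsCount A Q M → IsCount A R L →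
    (∀ x → (∀ i → P i x) → Q x) → (2 ≤ s → ∀ i x → P i x → R x) →
    sum (map N (allFin s)) ≤ M + (s ∸ 1) * L
  counting-bound {s} {N = N} {M} {L} countP countQ countR all⇒Q some⇒R = begin
    sum (map N (allFin s))
      ≡⟨ cong sum (map-cong (λ i → count≡sum-𝟙 (countP i)) (allFin s)) ⟩
    sum (map (λ i → sum (map (b i) elements)) (allFin s))
      ≡⟨ sum-map-swap b (allFin s) elements ⟩
    sum (map (λ x → sum (map (λ i → b i x) (allFin s))) elements)
      ≤⟨ sum-map-mono elements pointwise ⟩
    sum (map (λ x → c x + (s ∸ 1) * e x) elements)
      ≡⟨ sum-map-+ c (λ x → (s ∸ 1) * e x) elements ⟩
    sum (map c elements) + sum (map (λ x → (s ∸ 1) * e x) elements)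
      ≡⟨ cong (sum (map c elements) +_) (sum-map-* (s ∸ 1) e elements) ⟩
    sum (map c elements) + (s ∸ 1) * sum (map e elements)
      ≡⟨ cong₂ (λ y z → y + (s ∸ 1) * z) (sym (count≡sum-𝟙 countQ)) (sym (count≡sum-𝟙 countR)) ⟩
    M + (s ∸ 1) * L ∎
    where
    open ≤-Reasoning
    b : Fin s → A → ℕ
    b i = 𝟙 (proj₁ (countP i))
    c e : A → ℕ
    c = 𝟙 (proj₁ countQ)
    e = 𝟙 (proj₁ countR)

    pointwise : ∀ x → sum (map (λ i → b i x) (allFin s)) ≤ c x + (s ∸ 1) * e x
    pointwise x = subst (λ t → sum bs ≤ c x + (t ∸ 1) * e x) length-bs
                    (indicator-bound bs (c x) (e x) bits every⇒c some⇒e)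
      where
      bs = map (λ i → b i x) (allFin s)
      length-bs : length bs ≡ s
      length-bs = trans (length-map _ (allFin s)) (length-tabulate _)
      bits : Bits bs
      bits = All.map⁺ (All.universal (λ i → 𝟙≤1 _ x) (allFin s))
      every⇒c : All.All (_≡ 1) bs → 1 ≤ c x
      every⇒c every = ≤-reflexive (sym (holds⇒𝟙≡1 countQ (all⇒Q x λ i →
        𝟙≡1⇒holds (countP i) (All.lookup (All.map⁻ every) (∈-allFin i)))))
      some⇒e : 2 ≤ length bs → Any (_≡ 1) bs → 1 ≤ e x
      some⇒e 2≤s some with satisfied (Any.map⁻ some)
      ... | i , bᵢ≡1 = ≤-reflexive (sym (holds⇒𝟙≡1 countR
            (some⇒R (subst (2 ≤_) length-bs 2≤s) i x (𝟙≡1⇒holds (countP i) bᵢ≡1))))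

module Divisors where
  open import Data.Nat using (ℕ; zero; suc; _≤_; s≤s)
  open import Data.Nat.Divisibility using (_∣_; ∣-trans; m∣m*n; n∣m*n; ∣1⇒≡1)
  open import Data.Nat.Coprimality using (Coprime; coprime-divisor)
  open import Data.Nat.GCD using (gcd; gcd[m,n]∣m)
  open import Data.Nat.LCM using (lcm-least)
  open import Data.Fin using (Fin; zero; suc)
  open import Data.List using ([]; _∷_; lookup)
  open import Relation.Binary.PropositionalEquality using (_≡_; _≢_; subst)
  open import Defs using (lcmList)

  coprime-divisor-of-lcm : ∀ rs {d} → (∀ i → Coprime d (lookup rs i)) → d ∣ lcmList rs → d ≡ 1
  coprime-divisor-of-lcm []       _        d∣1   = ∣1⇒≡1 d∣1
  coprime-divisor-of-lcm (r ∷ rs) coprime d∣lcm =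
    coprime-divisor-of-lcm rs (λ i → coprime (suc i))
      (coprime-divisor (coprime zero) (∣-trans d∣lcm (lcm-least (m∣m*n {r} (lcmList rs)) (n∣m*n r))))

  common-gcd-∣ : ∀ {s} (f : Fin s → ℕ) {r₀} → (∀ i j → i ≢ j → gcd (f i) (f j) ≡ r₀) →
                 2 ≤ s → ∀ i → r₀ ∣ f i
  common-gcd-∣ {suc zero}    f gcd≡r₀ (s≤s ()) _
  common-gcd-∣ {suc (suc _)} f gcd≡r₀ _ zero =
    subst (_∣ f zero) (gcd≡r₀ zero (suc zero) λ ()) (gcd[m,n]∣m (f zero) (f (suc zero)))
  common-gcd-∣ {suc (suc _)} f gcd≡r₀ _ (suc i) =
    subst (_∣ f (suc i)) (gcd≡r₀ (suc i) zero λ ()) (gcd[m,n]∣m (f (suc i)) (f zero))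

module Freeness {n : ℕ} (K : FiniteField n) where
  open FiniteField K
  open import Level using (0ℓ)
  open import Data.Nat using (zero; suc) renaming (_*_ to _*ℕ_)
  open import Data.Nat.Divisibility using (_∣_; divides; ∣-trans)
  open import Data.Nat.Coprimality using (Coprime)
  open import Data.Fin using (Fin)
  import Data.Fin.Properties as Fin
  open import Data.List using (length; lookup; map; allFin)
  open import Data.List.Membership.Propositional.Properties using (∈-map⁺; ∈-allFin)
  import Data.List.Relation.Unary.Unique.Propositional.Properties as Unique
  open import Data.Product using (_,_; proj₁; proj₂)
  open import Algebra.Bundles using (CommutativeRing)
  open import Algebra.Structures using (IsCommutativeRing)
  open import Function.Bundles using (Inverse; Injection)
  open import Function.Properties.Inverse using (Inverse⇒Injection; ↔-sym)
  open import Relation.Binary.PropositionalEquality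
    using (_≡_; _≢_; refl; sym; trans; cong; subst; module ≡-Reasoning)
  open import Relation.Nullary.Decidable using (via-injection)
  open import Defs using (lcmList; IsFree; IsPower; NProp)
  open Divisors using (coprime-divisor-of-lcm)
  open IsCommutativeRing isCommutativeRing using (*-assoc; *-comm; *-identityˡ; zeroʳ)

  elements : List Carrier
  elements = map (Inverse.to enumeration) (allFin n)

  elements-unique : Unique elements
  elements-unique = Unique.map⁺ (Injection.injective (Inverse⇒Injection enumeration)) (Unique.allFin⁺ n)

  elements-complete : ∀ x → x ∈ elements
  elements-complete x = subst (_∈ elements) (Inverse.strictlyInverseˡ enumeration x)
                          (∈-map⁺ (Inverse.to enumeration) (∈-allFin (Inverse.from enumeration x)))

  _≟_ : DecidableEquality Carrier
  _≟_ = via-injection (Inverse⇒Injection (↔-sym enumeration)) Fin._≟_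

  *-nonzero : ∀ {a b} → a ≢ 0# → b ≢ 0# → a * b ≢ 0#
  *-nonzero {a} {b} a≢0 b≢0 ab≡0 with inverse a a≢0
  ... | a⁻¹ , aa⁻¹≡1 = b≢0 (begin
    b             ≡⟨ sym (*-identityˡ b) ⟩
    1# * b        ≡⟨ cong (_* b) (trans (sym aa⁻¹≡1) (*-comm a a⁻¹)) ⟩
    a⁻¹ * a * b   ≡⟨ *-assoc a⁻¹ a b ⟩
    a⁻¹ * (a * b) ≡⟨ cong (a⁻¹ *_) ab≡0 ⟩
    a⁻¹ * 0#      ≡⟨ zeroʳ a⁻¹ ⟩
    0#            ∎)
    where open ≡-Reasoning

  ^ᶠ-nonzero : ∀ {ζ} k → ζ ≢ 0# → ζ ^ᶠ k ≢ 0#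
  ^ᶠ-nonzero zero    _   1≡0 = 0≢1 (sym 1≡0)
  ^ᶠ-nonzero (suc k) ζ≢0     = *-nonzero ζ≢0 (^ᶠ-nonzero k ζ≢0)

  ring : CommutativeRing 0ℓ 0ℓ
  ring = record
    { Carrier = Carrier ; _≈_ = _≡_ ; _+_ = _+_ ; _*_ = _*_ ; -_ = -_ ; 0# = 0# ; 1# = 1#
    ; isCommutativeRing = isCommutativeRing }

  open import Algebra.Properties.Semiring.Exp (CommutativeRing.semiring ring) using (_^_; ^-assocʳ)

  ^ᶠ≡^ : ∀ x k → x ^ᶠ k ≡ x ^ k
  ^ᶠ≡^ x zero    = refl
  ^ᶠ≡^ x (suc k) = cong (x *_) (^ᶠ≡^ x k)

  ^ᶠ-assoc : ∀ x k e → (x ^ᶠ k) ^ᶠ e ≡ x ^ᶠ (k *ℕ e)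
  ^ᶠ-assoc x k e = begin
    (x ^ᶠ k) ^ᶠ e ≡⟨ ^ᶠ≡^ (x ^ᶠ k) e ⟩
    (x ^ᶠ k) ^ e  ≡⟨ cong (_^ e) (^ᶠ≡^ x k) ⟩
    (x ^ k) ^ e   ≡⟨ ^-assocʳ x k e ⟩
    x ^ (k *ℕ e)  ≡⟨ sym (^ᶠ≡^ x (k *ℕ e)) ⟩
    x ^ᶠ (k *ℕ e) ∎
    where open ≡-Reasoning

  power-divisor : ∀ {d e ξ} → e ∣ d → IsPower K d ξ → IsPower K e ξ
  power-divisor {e = e} (divides k refl) (ζ , ζ≢0 , ξ≡ζ^d) =
    ζ ^ᶠ k , ^ᶠ-nonzero k ζ≢0 , trans ξ≡ζ^d (sym (^ᶠ-assoc ζ k e))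

  free-divisor : ∀ {l r ξ} → r ∣ l → IsFree K l ξ → IsFree K r ξ
  free-divisor r∣l free d d∣r = free d (∣-trans d∣r r∣l)

  -- An element that is rᵢ-free for every i is lcm(r₁,…,r_s)-free: if
  -- ξ = ζ^d with d ∣ lcm, every common divisor e of d and rᵢ makes ξ an
  -- e-th power, so e = 1; hence d is coprime to every rᵢ and d = 1.
  free-lcm : ∀ rs {ξ} → (∀ i → IsFree K (lookup rs i) ξ) → IsFree K (lcmList rs) ξ
  free-lcm rs free d d∣lcm ζ ζ≢0 ξ≡ζ^d = coprime-divisor-of-lcm rs coprime d∣lcm
    where
    coprime : ∀ i → Coprime d (lookup rs i)
    coprime i {e} (e∣d , e∣rᵢ) with power-divisor e∣d (ζ , ζ≢0 , ξ≡ζ^d)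
    ... | η , η≢0 , ξ≡η^e = free i e e∣rᵢ η η≢0 ξ≡η^e

  NProp-divisor : ∀ {q l r θ α x} → r ∣ l → NProp K q l θ α x → NProp K q r θ α x
  NProp-divisor r∣l (x∈F_q , free , square , ¬fourth) = x∈F_q , free-divisor r∣l free , square , ¬fourth

  NProp-lcm : ∀ {q θ α x} rs → Fin (length rs) → (∀ i → NProp K q (lookup rs i) θ α x) →
              NProp K q (lcmList rs) θ α x
  NProp-lcm rs i₀ inAll with inAll i₀
  ... | x∈F_q , _ , square , ¬fourth = x∈F_q , free-lcm rs (λ i → proj₁ (proj₂ (inAll i))) , square , ¬fourth

module IntegerBound where
  open import Data.Nat using (ℕ; _+_; _∸_) renaming (_≤_ to _≤ℕ_)
  open import Data.Nat.Properties using (m≤n+m; m+n∸n≡m)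
  open import Data.Integer using (+_; _-_; _⊖_; _≤_)
  open import Data.Integer.Properties using ([+m]-[+n]≡m⊖n; ⊖-monoˡ-≤; ≤-⊖; module ≤-Reasoning)
  open import Relation.Binary.PropositionalEquality using (cong)

  ℕ-bound⇒ℤ-bound : ∀ {t b m} → t ≤ℕ m + b → + t - + b ≤ + m
  ℕ-bound⇒ℤ-bound {t} {b} {m} t≤m+b = begin
    + t - + b      ≡⟨ [+m]-[+n]≡m⊖n t b ⟩
    t ⊖ b          ≤⟨ ⊖-monoˡ-≤ b t≤m+b ⟩
    (m + b) ⊖ b    ≡⟨ ≤-⊖ (m≤n+m b m) ⟩
    + (m + b ∸ b)  ≡⟨ cong +_ (m+n∸n≡m m b) ⟩
    + m            ∎
    where open ≤-Reasoning

open import Defs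
open import Data.Nat using (ℕ; _≤_; _^_; _∸_)
open import Data.Nat.Divisibility using (_∣_)
open import Data.Nat.GCD using (gcd)
open import Data.Integer using (ℤ; +_; _-_; _*_) renaming (_≥_ to _≥ℤ_)
open import Data.Fin using (Fin)
open import Data.List using (List; length; lookup; map; allFin)
open import Data.Nat.ListAction using (sum)
open import Data.List.Relation.Unary.All using (All)
open import Data.List.Relation.Unary.Unique.Propositional using (Unique)
open import Relation.Binary.PropositionalEquality using (_≡_; _≢_)
open import Relation.Nullary using (¬_)

open import Data.Fin using (fromℕ<)
open import Data.Integer using () renaming (_≤_ to _≤ℤ_)
open import Data.Integer.Properties using (pos-*)
open import Relation.Binary.PropositionalEquality using (subst)
open Divisors using (common-gcd-∣)
open IntegerBound using (ℕ-bound⇒ℤ-bound)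

proposition2 :
    (q : ℕ) → OddPrimePower q → (K : FiniteField (q ^ 2)) →
    (m : ℕ) → m ∣ R′ (q ^ 2 ∸ 1) →
    (θ α : FiniteField.Carrier K) → θ ≢ FiniteField.0# K → α ≢ FiniteField.0# K →
    ¬ InSubfield K q θ →
    (rs : List ℕ) → 1 ≤ length rs → Unique rs → All (_∣ m) rs →
    (r₀ : ℕ) →
    (∀ (i j : Fin (length rs)) → i ≢ j → gcd (lookup rs i) (lookup rs j) ≡ r₀) →
    lcmList rs ≡ m →
    (Nm : ℕ) → IsN K q m θ α Nm →
    (N : Fin (length rs) → ℕ) → (∀ i → IsN K q (lookup rs i) θ α (N i)) →
    (N₀ : ℕ) → IsN K q r₀ θ α N₀ →
    (+ Nm) ≥ℤ ((+ sum (map N (allFin (length rs)))) - (+ (length rs ∸ 1)) * (+ N₀))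
proposition2 q _ K m _ θ α _ _ _ rs 1≤s _ _ r₀ gcd≡r₀ lcm≡m Nm countₘ N countᵢ N₀ count₀ =
  subst (λ b → + sum (map N (allFin s)) - b ≤ℤ + Nm) (pos-* (s ∸ 1) N₀)
        (ℕ-bound⇒ℤ-bound (counting-bound countᵢ countₘ count₀ all⇒m some⇒r₀))
  where
  open Freeness K
  open Counting _≟_ elements elements-unique elements-complete using (counting-bound)
  s = length rs

  all⇒m : ∀ x → (∀ i → NProp K q (lookup rs i) θ α x) → NProp K q m θ α x
  all⇒m x inAll = subst (λ l → NProp K q l θ α x) lcm≡m (NProp-lcm {q = q} rs (fromℕ< 1≤s) inAll)

  some⇒r₀ : 2 ≤ s → ∀ i x → NProp K q (lookup rs i) θ α x → NProp K q r₀ θ α x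
  some⇒r₀ 2≤s i x = NProp-divisor {q = q} (common-gcd-∣ (lookup rs) gcd≡r₀ 2≤s i)
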